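{- Let $\Gamma$ be a tiled order with structural invariants $m_{ij\ell}$ and types of distinguished vertices $t_i$, and let $\xi=(\varpi^{\alpha_i}\delta_{\sigma(i)j})$ be a monomial matrix. Then $\Gamma' \coloneqq \xi \Gamma \xi^{ -1}$ has structural invariants and types of distinguished vertices \[ m'_{ij\ell}=m_{\sigma(i)\sigma(j)\sigma(\ell)} \quad \text{and} \quad t'_i=t(\xi)+t_{\sigma(i)}\] for all $i,j,\ell \le n$, and $\xi [P_{\sigma(i)}]=[P'_i]$ for all $i \le n$.
   Context: Let $k$ be a non-archimedean local field of characteristic $0$ with valuation ring $R$, uniformizer $\pi$, and let $D$ be a central division algebra of degree $m$ over $k$ with unique maximal $R$-order $\Delta$ and prime element $\varpi\in\Delta$ with $\varpi^m=\pi$; let $v_D$ be the normalized valuation on $D$. A tiled order $\Gamma\subseteq M_n(D)$ is one containing a conjugate of $\mathrm{diag}(\Delta,\dots,\Delta)$; assume $\Gamma\supseteq\mathrm{diag}(\Delta,\dots,\Delta)$, so that $\Gamma=(\mathfrak{p}^{\mu_{ij}})$ with $\mathfrak{p}=\varpi\Delta$, $\mu_{ii}=0$ and $\mu_{ij}+\mu_{jk}\ge\mu_{ik}$ for all $i,j,k\le n$. The structural invariants of $\Gamma$ are $m_{ij\ell}=\mu_{ij}+\mu_{j\ell}-\mu_{i\ell}$. In the apartment associated to the standard basis $e_1,\dots,e_n$, the vertex $[a_1,\dots,a_n]$ denotes the homothety class of the lattice $\Delta\varpi^{a_1}e_1\oplus\dots\oplus\Delta\varpi^{a_n}e_n$;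 the distinguished vertices of $\Gamma$ are $[P_j]=[\mu_{1j},\mu_{2j},\dots,\mu_{nj}]$ (homothety classes of the columns of $\Gamma$), and $t_j=t[P_j]$. The type of $g\in\mathrm{GL}_n(D)$ is $t(g)=v_D(\det g)\bmod n$ with $\det$ the Dieudonné determinant; the type of a vertex $[a_1,\dots,a_n]$ is $\sum_i a_i \bmod n$, and $g$ sends a vertex of type $t$ to one of type $t+t(g)\bmod n$. For a monomial matrix $\xi=(\varpi^{\alpha_i}\delta_{\sigma(i)j})$ with $\sigma\in S_n$, $t(\xi)\equiv\sum_i\alpha_i \pmod n$. Primed quantities $m'_{ij\ell}, t'_i, [P'_i]$ denote the corresponding data of $\Gamma'$. -}

module Defs where

open import Level using (Level; _⊔_; Lift) renaming (suc to lsuc)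
open import Algebra.Bundles using (Ring)
import Algebra.Definitions.RawMonoid as RawMonoidDefs
open import Data.Nat.Base using (ℕ; zero; suc)
open import Data.Integer.Base as ℤ using (ℤ; +_; -[1+_]; _-_) renaming (_+_ to _+ℤ_; _≤_ to _≤ℤ_)
open import Data.Integer.Divisibility using (_∣_)
open import Data.Fin.Base using (Fin; zero; suc)
open import Data.Fin.Properties using (_≟_)
open import Data.Fin.Permutation using (Permutation′; _⟨$⟩ʳ_)
open import Data.Product using (Σ; ∃; _×_; _,_)
open import Relation.Nullary using (¬_; yes; no)
open import Relation.Binary.PropositionalEquality using (_≡_)

data ℤ∞ : Set where
  fin : ℤ → ℤ∞
  ∞   : ℤ∞

infix 4 _≤∞_
data _≤∞_ : ℤ∞ → ℤ∞ → Set where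
  fin≤fin : ∀ {a b} → a ≤ℤ b → fin a ≤∞ fin b
  _≤∞∞    : ∀ x → x ≤∞ ∞

infixl 6 _+∞_
_+∞_ : ℤ∞ → ℤ∞ → ℤ∞
fin a +∞ fin b = fin (a +ℤ b)
fin _ +∞ ∞     = ∞
∞     +∞ _     = ∞

min∞ : ℤ∞ → ℤ∞ → ℤ∞
min∞ (fin a) (fin b) = fin (a ℤ.⊓ b)
min∞ (fin a) ∞       = fin a
min∞ ∞       y       = y

-- A (skew) division ring D with a normalized discrete valuation v_D
-- and a prime element ϖ (v_D ϖ = 1).  (Abstraction of the paper's
-- central division algebra over a non-archimedean local field.)

record ValuedDivisionRing (c ℓ : Level) : Set (lsuc (c ⊔ ℓ)) where
  field
    ring : Ring c ℓ
  open Ring ring public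
  field
    _⁻¹        : Carrier → Carrier
    ⁻¹-inverseʳ : ∀ x → ¬ (x ≈ 0#) → (x * (x ⁻¹)) ≈ 1#
    ⁻¹-inverseˡ : ∀ x → ¬ (x ≈ 0#) → ((x ⁻¹) * x) ≈ 1#
    1≉0         : ¬ (1# ≈ 0#)
    v           : Carrier → ℤ∞
    v-cong      : ∀ {x y} → x ≈ y → v x ≡ v y
    v-∞⇒0       : ∀ x → v x ≡ ∞ → x ≈ 0#
    v-0         : v 0# ≡ ∞
    v-*         : ∀ x y → v (x * y) ≡ v x +∞ v y
    v-+         : ∀ x y → min∞ (v x) (v y) ≤∞ v (x + y)
    ϖ           : Carrier
    v-ϖ         : v ϖ ≡ fin (+ 1)

sumℤ : ∀ {n} → (Fin n → ℤ) → ℤ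
sumℤ {zero}  f = + 0
sumℤ {suc n} f = f zero +ℤ sumℤ (λ i → f (suc i))

infix 4 _≡_[mod_]
_≡_[mod_] : ℤ → ℤ → ℕ → Set
a ≡ b [mod n ] = (+ n) ∣ (a - b)

ExpMat : ℕ → Set
ExpMat n = Fin n → Fin n → ℤ

strInv : ∀ {n} → ExpMat n → Fin n → Fin n → Fin n → ℤ
strInv μ i j l = (μ i j +ℤ μ j l) - μ i l

-- distinguished vertex [P_j] = [μ_1j, …, μ_nj]  (j-th column)
P : ∀ {n} → ExpMat n → Fin n → (Fin n → ℤ)
P μ j = λ i → μ i j

-- type of a vertex [a_1,…,a_n] (as an integer; compared mod n)
vertexType : ∀ {n} → (Fin n → ℤ) → ℤ
vertexType a = sumℤ a

tDist : ∀ {n} → ExpMat n → Fin n → ℤ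
tDist μ j = vertexType (P μ j)

-- type of the monomial matrix ξ = (ϖ^{α_i} δ_{σ(i)j}):  t(ξ) ≡ Σ α_i (mod n)
tMono : ∀ {n} → (Fin n → ℤ) → ℤ
tMono α = sumℤ α

module Theory {c ℓ} (K : ValuedDivisionRing c ℓ) where
  open ValuedDivisionRing K
  open RawMonoidDefs +-rawMonoid using (sum)

  Mat : ℕ → Set c
  Mat n = Fin n → Fin n → Carrier

  Vect : ℕ → Set c
  Vect n = Fin n → Carrier

  infix 4 _≈ᴹ_ _≈ⱽ_
  _≈ᴹ_ : ∀ {n} → Mat n → Mat n → Set ℓ
  A ≈ᴹ B = ∀ i j → A i j ≈ B i j

  _≈ⱽ_ : ∀ {n} → Vect n → Vect n → Set ℓ
  x ≈ⱽ y = ∀ i → x i ≈ y i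

  infixl 7 _⊗_ _⊛_
  _⊗_ : ∀ {n} → Mat n → Mat n → Mat n
  (A ⊗ B) i j = sum (λ k → A i k * B k j)

  _⊛_ : ∀ {n} → Mat n → Vect n → Vect n
  (A ⊛ x) i = sum (λ k → A i k * x k)

  I : ∀ {n} → Mat n
  I i j with i ≟ j
  ... | yes _ = 1#
  ... | no  _ = 0#

  IsInverse : ∀ {n} → Mat n → Mat n → Set ℓ
  IsInverse A B = (A ⊗ B ≈ᴹ I) × (B ⊗ A ≈ᴹ I)

  powℕ : Carrier → ℕ → Carrier
  powℕ x zero    = 1#
  powℕ x (suc k) = x * powℕ x k

  ϖ^ : ℤ → Carrier
  ϖ^ (+ k)      = powℕ ϖ k
  ϖ^ -[1+ k ]   = powℕ (ϖ ⁻¹) (suc k)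

  monomial : ∀ {n} → Permutation′ n → (Fin n → ℤ) → Mat n
  monomial σ α i j with (σ ⟨$⟩ʳ i) ≟ j
  ... | yes _ = ϖ^ (α i)
  ... | no  _ = 0#

  MatSet : ℕ → Set (lsuc (c ⊔ ℓ))
  MatSet n = Mat n → Set (c ⊔ ℓ)

  VSet : ℕ → Set (lsuc (c ⊔ ℓ))
  VSet n = Vect n → Set (c ⊔ ℓ)

  tiled : ∀ {n} → ExpMat n → MatSet n
  tiled μ M = Lift (c ⊔ ℓ) (∀ i j → fin (μ i j) ≤∞ v (M i j))

  -- ξ S ξ⁻¹, where ξinv is the inverse of ξ
  conj : ∀ {n} → Mat n → Mat n → MatSet n → MatSet n
  conj ξ ξinv S M = ∃ λ N → S N × (M ≈ᴹ (ξ ⊗ N) ⊗ ξinv)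

  HasExponents : ∀ {n} → MatSet n → ExpMat n → Set (c ⊔ ℓ)
  HasExponents S μ = ∀ M → (S M → tiled μ M) × (tiled μ M → S M)

  lattice : ∀ {n} → (Fin n → ℤ) → VSet n
  lattice a x = Lift (c ⊔ ℓ) (∀ i → fin (a i) ≤∞ v (x i))

  _·L_ : ∀ {n} → Mat n → VSet n → VSet n
  (g ·L L) y = ∃ λ x → L x × (y ≈ⱽ g ⊛ x)

  -- L c (scalar homothety, scalars acting on the right of column vectors)
  _·s_ : ∀ {n} → VSet n → Carrier → VSet n
  (L ·s c′) y = ∃ λ x → L x × (y ≈ⱽ (λ i → x i * c′))

  _≐_ : ∀ {n} → VSet n → VSet n → Set (c ⊔ ℓ)
  A ≐ B = ∀ y → (A y → B y) × (B y → A y)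

  SameClass : ∀ {n} → VSet n → VSet n → Set (c ⊔ ℓ)
  SameClass L L′ = Σ Carrier λ c′ → ¬ (c′ ≈ 0#) × (L′ ≐ (L ·s c′))

{-# OPTIONS --safe #-}
-- Entrywise, (ξ N ξ⁻¹)ᵢⱼ = ϖ^{αᵢ} N_{σ(i)σ(j)} ϖ^{-αⱼ}, so Γ′ is the tiled order with
-- exponents μ′ᵢⱼ = αᵢ + μ_{σ(i)σ(j)} − αⱼ.  The α's telescope away in the structural
-- invariants; summing column i of μ′ gives Σα + (column σ(i) of μ, permuted) − n αᵢ,
-- whence the types.  Finally ξ maps the lattice with exponents a onto the one with
-- exponents αₖ + a_{σ(k)}, which for a = P_{σ(i)} is P′ᵢ shifted by the scalar αᵢ.
module Submission where

open import Defs
open import Level using (lift; lower)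
open import Data.Nat.Base using (ℕ; zero; suc)
import Data.Nat.Divisibility as ℕ
open import Data.Integer.Base using (ℤ; _≤_; _+_; _-_; -_; _*_; +_; -[1+_])
open import Data.Integer.Properties
  using ( abs-*; *-identityʳ; suc-*; *-comm; -1*i≡-i; *-zeroˡ; +-monoʳ-≤; +-monoˡ-≤; ≤-refl; ≤-antisym
        ; +-0-commutativeMonoid; +-0-abelianGroup )
open import Data.Integer.Divisibility using (_∣_)
open import Data.Integer.Tactic.RingSolver using (solve-∀)
open import Data.Fin.Base using (Fin; zero; suc; punchIn)
open import Data.Fin.Properties using (_≟_; punchInᵢ≢i)
open import Data.Fin.Permutation using (Permutation′; _⟨$⟩ʳ_; _⟨$⟩ˡ_; inverseˡ; inverseʳ)
open import Data.Product using (Σ; _×_; _,_; proj₁; proj₂)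
open import Data.Empty using (⊥-elim)
open import Relation.Nullary using (¬_; yes; no)
open import Relation.Binary.PropositionalEquality
  using (_≡_; _≢_; refl; sym; trans; cong; cong₂; subst; module ≡-Reasoning)
import Algebra.Properties.AbelianGroup as AbelianGroupProperties
import Algebra.Properties.CommutativeMonoid.Sum as CommutativeMonoidSum
import Relation.Binary.Reasoning.Setoid as SetoidReasoning

fin-injective : ∀ {a b} → fin a ≡ fin b → a ≡ b
fin-injective refl = refl

fin≤fin⁻¹ : ∀ {a b} → fin a ≤∞ fin b → a ≤ b
fin≤fin⁻¹ (fin≤fin a≤b) = a≤b

≤∞-+ˡ : ∀ p {m y} → fin m ≤∞ y → fin (p + m) ≤∞ fin p +∞ y
≤∞-+ˡ p (fin≤fin m≤b) = fin≤fin (+-monoʳ-≤ p m≤b)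
≤∞-+ˡ p (_ ≤∞∞)       = _ ≤∞∞

≤∞-+ʳ : ∀ q {m y} → fin m ≤∞ y → fin (m + q) ≤∞ y +∞ fin q
≤∞-+ʳ q (fin≤fin m≤b) = fin≤fin (+-monoˡ-≤ q m≤b)
≤∞-+ʳ q (_ ≤∞∞)       = _ ≤∞∞

≤∞-respˡ : ∀ {a b y} → a ≡ b → fin a ≤∞ y → fin b ≤∞ y
≤∞-respˡ refl a≤y = a≤y

≤∞-respʳ : ∀ {x y z} → y ≡ z → x ≤∞ y → x ≤∞ z
≤∞-respʳ refl x≤y = x≤y

module ℤΣ = CommutativeMonoidSum +-0-commutativeMonoid

sumℤ≡sum : ∀ {n} (f : Fin n → ℤ) → sumℤ f ≡ ℤΣ.sum f
sumℤ≡sum {zero}  f = refl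
sumℤ≡sum {suc n} f = cong (λ s → f zero + s) (sumℤ≡sum (λ k → f (suc k)))

sumℤ-cong : ∀ {n} {f g : Fin n → ℤ} → (∀ k → f k ≡ g k) → sumℤ f ≡ sumℤ g
sumℤ-cong {f = f} {g} f≗g =
  trans (sumℤ≡sum f) (trans (ℤΣ.sum-cong-≗ f≗g) (sym (sumℤ≡sum g)))

sumℤ-+ : ∀ {n} (f g : Fin n → ℤ) → sumℤ (λ k → f k + g k) ≡ sumℤ f + sumℤ g
sumℤ-+ f g = begin
  sumℤ (λ k → f k + g k)   ≡⟨ sumℤ≡sum (λ k → f k + g k) ⟩
  ℤΣ.sum (λ k → f k + g k) ≡⟨ ℤΣ.∑-distrib-+ f g ⟩
  ℤΣ.sum f + ℤΣ.sum g      ≡⟨ sym (cong₂ _+_ (sumℤ≡sum f) (sumℤ≡sum g)) ⟩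
  sumℤ f + sumℤ g          ∎
  where open ≡-Reasoning

sumℤ-permute : ∀ {n} (σ : Permutation′ n) (f : Fin n → ℤ) → sumℤ (λ k → f (σ ⟨$⟩ʳ k)) ≡ sumℤ f
sumℤ-permute σ f = begin
  sumℤ (λ k → f (σ ⟨$⟩ʳ k))   ≡⟨ sumℤ≡sum (λ k → f (σ ⟨$⟩ʳ k)) ⟩
  ℤΣ.sum (λ k → f (σ ⟨$⟩ʳ k)) ≡⟨ sym (ℤΣ.sum-permute f σ) ⟩
  ℤΣ.sum f                    ≡⟨ sym (sumℤ≡sum f) ⟩
  sumℤ f                      ∎
  where open ≡-Reasoning

sumℤ-const : ∀ n c → sumℤ {n} (λ _ → c) ≡ + n * c
sumℤ-const zero    c = sym (*-zeroˡ c)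
sumℤ-const (suc n) c = trans (cong (λ s → c + s) (sumℤ-const n c)) (sym (suc-* (+ n) c))

conjExponents : ∀ {n} → Permutation′ n → (Fin n → ℤ) → ExpMat n → ExpMat n
conjExponents σ α μ i j = (α i + μ (σ ⟨$⟩ʳ i) (σ ⟨$⟩ʳ j)) - α j

strInv-cong : ∀ {n} {μ ν : ExpMat n} → (∀ i j → μ i j ≡ ν i j) →
              ∀ i j l → strInv μ i j l ≡ strInv ν i j l
strInv-cong μ≡ν i j l = cong₂ _-_ (cong₂ _+_ (μ≡ν i j) (μ≡ν j l)) (μ≡ν i l)

tDist-cong : ∀ {n} {μ ν : ExpMat n} → (∀ i j → μ i j ≡ ν i j) → ∀ j → tDist μ j ≡ tDist ν j
tDist-cong μ≡ν j = sumℤ-cong (λ i → μ≡ν i j)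

strInv-conjExponents : ∀ {n} (σ : Permutation′ n) α (μ : ExpMat n) i j l →
  strInv (conjExponents σ α μ) i j l ≡ strInv μ (σ ⟨$⟩ʳ i) (σ ⟨$⟩ʳ j) (σ ⟨$⟩ʳ l)
strInv-conjExponents σ α μ i j l = telescope (α i) (α j) (α l) _ _ _
  where
  telescope : ∀ a b c x y z → (((a + x) - b) + ((b + y) - c)) - ((a + z) - c) ≡ (x + y) - z
  telescope = solve-∀

tDist-conjExponents : ∀ {n} (σ : Permutation′ n) α (μ : ExpMat n) i →
  tDist (conjExponents σ α μ) i ≡ tMono α + tDist μ (σ ⟨$⟩ʳ i) [mod n ]
tDist-conjExponents {n} σ α μ i =
  subst (+ n ∣_) (sym difference) (subst (ℕ._∣_ n) (sym (abs-* (+ n) (- α i))) (ℕ.m∣m*n _))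
  where
  open ≡-Reasoning
  A = sumℤ α
  B = tDist μ (σ ⟨$⟩ʳ i)
  C = sumℤ {n} (λ _ → - α i)
  [x+y]-x≡y : ∀ x y → (x + y) - x ≡ y
  [x+y]-x≡y = solve-∀
  difference : tDist (conjExponents σ α μ) i - (A + B) ≡ + n * (- α i)
  difference = begin
    sumℤ (λ k → (α k + μ (σ ⟨$⟩ʳ k) (σ ⟨$⟩ʳ i)) - α i) - (A + B)
      ≡⟨ cong (_- (A + B)) (sumℤ-+ (λ k → α k + μ (σ ⟨$⟩ʳ k) (σ ⟨$⟩ʳ i)) (λ _ → - α i)) ⟩
    (sumℤ (λ k → α k + μ (σ ⟨$⟩ʳ k) (σ ⟨$⟩ʳ i)) + C) - (A + B)
      ≡⟨ cong (λ s → (s + C) - (A + B))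
              (trans (sumℤ-+ α _) (cong (λ s → A + s) (sumℤ-permute σ (λ k → μ k (σ ⟨$⟩ʳ i))))) ⟩
    ((A + B) + C) - (A + B)  ≡⟨ [x+y]-x≡y (A + B) C ⟩
    C                        ≡⟨ sumℤ-const n (- α i) ⟩
    + n * (- α i)            ∎

module MonomialConjugation {c ℓ} (K : ValuedDivisionRing c ℓ) where
  open ValuedDivisionRing K
    using ( Carrier; _≈_; 0#; 1#; _⁻¹; ⁻¹-inverseʳ; 1≉0; v; v-cong; v-∞⇒0; v-0; v-*; v-ϖ
          ; setoid; zeroˡ; zeroʳ; +-congˡ; +-identityʳ; +-commutativeMonoid )
    renaming ( _*_ to _·_; _+_ to _⊕_; *-cong to ·-cong; *-assoc to ·-assoc
             ; *-identityˡ to ·-identityˡ; *-identityʳ to ·-identityʳ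
             ; refl to ≈-refl; sym to ≈-sym; trans to ≈-trans )
  open Theory K
  open CommutativeMonoidSum +-commutativeMonoid using (sum; sum-remove; sum-cong-≋; sum-replicate-zero)
  open AbelianGroupProperties +-0-abelianGroup using (identityʳ-unique; inverseʳ-unique)

  v-nonzero : ∀ {x p} → v x ≡ fin p → ¬ x ≈ 0#
  v-nonzero vx≡p x≈0 with () ← trans (sym vx≡p) (trans (v-cong x≈0) v-0)

  v-1# : v 1# ≡ fin (+ 0)
  v-1# with v 1# in v1≡
  ... | ∞     = ⊥-elim (1≉0 (v-∞⇒0 1# v1≡))
  ... | fin a = cong fin (identityʳ-unique a a (sym (fin-injective (begin
    fin a           ≡⟨ sym v1≡ ⟩
    v 1#            ≡⟨ v-cong (≈-sym (·-identityˡ 1#)) ⟩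
    v (1# · 1#)     ≡⟨ v-* 1# 1# ⟩
    v 1# +∞ v 1#    ≡⟨ cong₂ _+∞_ v1≡ v1≡ ⟩
    fin (a + a)     ∎))))
    where open ≡-Reasoning

  v-⁻¹ : ∀ {x p} → v x ≡ fin p → v (x ⁻¹) ≡ fin (- p)
  v-⁻¹ {x} {p} vx≡p with v (x ⁻¹) | v[x·x⁻¹]
    where
    v[x·x⁻¹] : fin p +∞ v (x ⁻¹) ≡ fin (+ 0)
    v[x·x⁻¹] = begin
      fin p +∞ v (x ⁻¹) ≡⟨ cong (_+∞ v (x ⁻¹)) (sym vx≡p) ⟩
      v x +∞ v (x ⁻¹)   ≡⟨ sym (v-* x (x ⁻¹)) ⟩
      v (x · x ⁻¹)      ≡⟨ v-cong (⁻¹-inverseʳ x (v-nonzero vx≡p)) ⟩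
      v 1#              ≡⟨ v-1# ⟩
      fin (+ 0)         ∎
      where open ≡-Reasoning
  ... | fin b | p+b≡0 = cong fin (inverseʳ-unique p b (fin-injective p+b≡0))

  v-powℕ : ∀ {x p} → v x ≡ fin p → ∀ k → v (powℕ x k) ≡ fin (+ k * p)
  v-powℕ vx≡p zero    = v-1#
  v-powℕ {x} {p} vx≡p (suc k) = begin
    v (x · powℕ x k)        ≡⟨ v-* x (powℕ x k) ⟩
    v x +∞ v (powℕ x k)     ≡⟨ cong₂ _+∞_ vx≡p (v-powℕ vx≡p k) ⟩
    fin (p + + k * p)       ≡⟨ cong fin (sym (suc-* (+ k) p)) ⟩
    fin (+ suc k * p)       ∎
    where open ≡-Reasoning

  v-ϖ^ : ∀ a → v (ϖ^ a) ≡ fin a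
  v-ϖ^ (+ k)     = trans (v-powℕ v-ϖ k) (cong fin (*-identityʳ (+ k)))
  v-ϖ^ -[1+ k ] = trans (v-powℕ (v-⁻¹ v-ϖ) (suc k)) (cong fin (trans (*-comm (+ suc k) (- + 1)) (-1*i≡-i (+ suc k))))

  v-·-monoˡ : ∀ {x y p m} → v x ≡ fin p → fin m ≤∞ v y → fin (p + m) ≤∞ v (x · y)
  v-·-monoˡ {x} {y} {p} vx≡p m≤vy =
    ≤∞-respʳ (sym (trans (v-* x y) (cong (_+∞ v y) vx≡p))) (≤∞-+ˡ p m≤vy)

  v-·-monoʳ : ∀ {x y q m} → v y ≡ fin q → fin m ≤∞ v x → fin (m + q) ≤∞ v (x · y)
  v-·-monoʳ {x} {y} {q} vy≡q m≤vx =
    ≤∞-respʳ (sym (trans (v-* x y) (cong (v x +∞_) vy≡q))) (≤∞-+ʳ q m≤vx)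

  v-ϖ^⁻¹ : ∀ a → v (ϖ^ a ⁻¹) ≡ fin (- a)
  v-ϖ^⁻¹ a = v-⁻¹ (v-ϖ^ a)

  ϖ^-inverseʳ : ∀ a → ϖ^ a · ϖ^ a ⁻¹ ≈ 1#
  ϖ^-inverseʳ a = ⁻¹-inverseʳ (ϖ^ a) (v-nonzero (v-ϖ^ a))

  ϖ^-cancelˡ : ∀ a x → ϖ^ a · (ϖ^ a ⁻¹ · x) ≈ x
  ϖ^-cancelˡ a x = begin
    ϖ^ a · (ϖ^ a ⁻¹ · x) ≈⟨ ≈-sym (·-assoc _ _ _) ⟩
    (ϖ^ a · ϖ^ a ⁻¹) · x ≈⟨ ·-cong (ϖ^-inverseʳ a) ≈-refl ⟩
    1# · x               ≈⟨ ·-identityˡ x ⟩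
    x                    ∎
    where open SetoidReasoning setoid

  ϖ^-cancelʳ : ∀ a x → (x · ϖ^ a) · ϖ^ a ⁻¹ ≈ x
  ϖ^-cancelʳ a x = begin
    (x · ϖ^ a) · ϖ^ a ⁻¹ ≈⟨ ·-assoc _ _ _ ⟩
    x · (ϖ^ a · ϖ^ a ⁻¹) ≈⟨ ·-cong ≈-refl (ϖ^-inverseʳ a) ⟩
    x · 1#               ≈⟨ ·-identityʳ x ⟩
    x                    ∎
    where open SetoidReasoning setoid

  ϖ^-sandwich-cancel : ∀ a b x → (ϖ^ a · ((ϖ^ a ⁻¹ · x) · ϖ^ b)) · ϖ^ b ⁻¹ ≈ x
  ϖ^-sandwich-cancel a b x = begin
    (ϖ^ a · ((ϖ^ a ⁻¹ · x) · ϖ^ b)) · ϖ^ b ⁻¹ ≈⟨ ·-cong (≈-sym (·-assoc _ _ _)) ≈-refl ⟩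
    ((ϖ^ a · (ϖ^ a ⁻¹ · x)) · ϖ^ b) · ϖ^ b ⁻¹ ≈⟨ ϖ^-cancelʳ b _ ⟩
    ϖ^ a · (ϖ^ a ⁻¹ · x)                      ≈⟨ ϖ^-cancelˡ a x ⟩
    x                                         ∎
    where open SetoidReasoning setoid

  unitMat : ∀ {n} → Fin n → Fin n → Carrier → Mat n
  unitMat i j x a b with a ≟ i | b ≟ j
  ... | yes _ | yes _ = x
  ... | _     | _     = 0#

  unitMat-at : ∀ {n} (i j : Fin n) x → unitMat i j x i j ≡ x
  unitMat-at i j x with i ≟ i | j ≟ j
  ... | yes _ | yes _  = refl
  ... | no i≢i | _     = ⊥-elim (i≢i refl)
  ... | yes _ | no j≢j = ⊥-elim (j≢j refl)

  unitMat-tiled : ∀ {n} (μ : ExpMat n) i j → tiled μ (unitMat i j (ϖ^ (μ i j)))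
  unitMat-tiled μ i j = lift entry
    where
    entry : ∀ a b → fin (μ a b) ≤∞ v (unitMat i j (ϖ^ (μ i j)) a b)
    entry a b with a ≟ i | b ≟ j
    ... | yes refl | yes refl = ≤∞-respʳ (sym (v-ϖ^ (μ a b))) (fin≤fin ≤-refl)
    ... | yes _    | no _     = ≤∞-respʳ (sym v-0) (_ ≤∞∞)
    ... | no _     | _        = ≤∞-respʳ (sym v-0) (_ ≤∞∞)

  tiled-antitone : ∀ {n} {μ ν : ExpMat n} → (∀ M → tiled μ M → tiled ν M) → ∀ i j → ν i j ≤ μ i j
  tiled-antitone {μ = μ} {ν} Γμ⊆Γν i j =
    fin≤fin⁻¹ (≤∞-respʳ (trans (cong v (unitMat-at i j _)) (v-ϖ^ (μ i j)))
                        (lower (Γμ⊆Γν _ (unitMat-tiled μ i j)) i j))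

  HasExponents-unique : ∀ {n} {S : MatSet n} {μ ν : ExpMat n} →
                        HasExponents S μ → HasExponents S ν → ∀ i j → μ i j ≡ ν i j
  HasExponents-unique Sμ Sν i j = ≤-antisym
    (tiled-antitone (λ M M∈Γν → proj₁ (Sμ M) (proj₂ (Sν M) M∈Γν)) i j)
    (tiled-antitone (λ M M∈Γμ → proj₁ (Sν M) (proj₂ (Sμ M) M∈Γμ)) i j)

  sum-single : ∀ {n} (f : Fin n → Carrier) j → (∀ k → k ≢ j → f k ≈ 0#) → sum f ≈ f j
  sum-single {suc n} f j vanishes = begin
    sum f                              ≈⟨ sum-remove {i = j} f ⟩
    f j ⊕ sum (λ k → f (punchIn j k))  ≈⟨ +-congˡ (sum-cong-≋ (λ k → vanishes _ (punchInᵢ≢i j k))) ⟩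
    f j ⊕ sum {n} (λ _ → 0#)           ≈⟨ +-congˡ (sum-replicate-zero n) ⟩
    f j ⊕ 0#                           ≈⟨ +-identityʳ (f j) ⟩
    f j                                ∎
    where open SetoidReasoning setoid

  I-diagonal : ∀ {n} (i : Fin n) → I i i ≈ 1#
  I-diagonal i with i ≟ i
  ... | yes _  = ≈-refl
  ... | no i≢i = ⊥-elim (i≢i refl)

  I-off-diagonal : ∀ {n} {i j : Fin n} → i ≢ j → I i j ≈ 0#
  I-off-diagonal {i = i} {j} i≢j with i ≟ j
  ... | yes i≡j = ⊥-elim (i≢j i≡j)
  ... | no _    = ≈-refl

  ≐-sym : ∀ {n} {A B : VSet n} → A ≐ B → B ≐ A
  ≐-sym A≐B y = proj₂ (A≐B y) , proj₁ (A≐B y)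

  ≐-trans : ∀ {n} {A B C : VSet n} → A ≐ B → B ≐ C → A ≐ C
  ≐-trans A≐B B≐C y = (λ y∈A → proj₁ (B≐C y) (proj₁ (A≐B y) y∈A))
                    , (λ y∈C → proj₂ (A≐B y) (proj₂ (B≐C y) y∈C))

  ·s-cong : ∀ {n} {A B : VSet n} c → A ≐ B → (A ·s c) ≐ (B ·s c)
  ·s-cong c A≐B y = (λ { (x , x∈A , y≈xc) → x , proj₁ (A≐B x) x∈A , y≈xc })
                  , (λ { (x , x∈B , y≈xc) → x , proj₂ (A≐B x) x∈B , y≈xc })

  lattice-cong : ∀ {n} {a b : Fin n → ℤ} → (∀ k → a k ≡ b k) → lattice a ≐ lattice b
  lattice-cong a≗b y = (λ { (lift y∈L) → lift λ k → ≤∞-respˡ (a≗b k) (y∈L k) })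
                     , (λ { (lift y∈L) → lift λ k → ≤∞-respˡ (sym (a≗b k)) (y∈L k) })

  lattice-homothety : ∀ {n} (a : Fin n → ℤ) c → lattice (λ k → a k - c) ≐ (lattice a ·s (ϖ^ c ⁻¹))
  lattice-homothety a c y = into , onto
    where
    [x-y]+y≡x : ∀ x y → (x - y) + y ≡ x
    [x-y]+y≡x = solve-∀
    into : lattice (λ k → a k - c) y → (lattice a ·s (ϖ^ c ⁻¹)) y
    into (lift y∈L) = (λ k → y k · ϖ^ c)
                    , lift (λ k → ≤∞-respˡ ([x-y]+y≡x (a k) c) (v-·-monoʳ (v-ϖ^ c) (y∈L k)))
                    , (λ k → ≈-sym (ϖ^-cancelʳ c (y k)))
    onto : (lattice a ·s (ϖ^ c ⁻¹)) y → lattice (λ k → a k - c) y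
    onto (x , lift x∈L , y≈xc) =
      lift λ k → ≤∞-respʳ (sym (v-cong (y≈xc k))) (v-·-monoʳ (v-ϖ^⁻¹ c) (x∈L k))

  module Monomial {n} (σ : Permutation′ n) (α : Fin n → ℤ) where
    ξ : Mat n
    ξ = monomial σ α

    σ-injective : ∀ {i j} → σ ⟨$⟩ʳ i ≡ σ ⟨$⟩ʳ j → i ≡ j
    σ-injective σi≡σj = trans (sym (inverseˡ σ)) (trans (cong (σ ⟨$⟩ˡ_) σi≡σj) (inverseˡ σ))

    monomial-on : ∀ k → ξ k (σ ⟨$⟩ʳ k) ≈ ϖ^ (α k)
    monomial-on k with (σ ⟨$⟩ʳ k) ≟ (σ ⟨$⟩ʳ k)
    ... | yes _    = ≈-refl
    ... | no σk≢σk = ⊥-elim (σk≢σk refl)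

    monomial-off : ∀ {k j} → σ ⟨$⟩ʳ k ≢ j → ξ k j ≈ 0#
    monomial-off {k} {j} σk≢j with (σ ⟨$⟩ʳ k) ≟ j
    ... | yes σk≡j = ⊥-elim (σk≢j σk≡j)
    ... | no _     = ≈-refl

    monomial-⊛ : ∀ x k → (ξ ⊛ x) k ≈ ϖ^ (α k) · x (σ ⟨$⟩ʳ k)
    monomial-⊛ x k = ≈-trans
      (sum-single _ (σ ⟨$⟩ʳ k) (λ l l≢σk → ≈-trans (·-cong (monomial-off (λ σk≡l → l≢σk (sym σk≡l))) ≈-refl) (zeroˡ _)))
      (·-cong (monomial-on k) ≈-refl)

    monomial-·L-lattice : ∀ a → (ξ ·L lattice a) ≐ lattice (λ k → α k + a (σ ⟨$⟩ʳ k))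
    monomial-·L-lattice a y = into , onto
      where
      -[x]+[x+y]≡y : ∀ x y → - x + (x + y) ≡ y
      -[x]+[x+y]≡y = solve-∀
      into : (ξ ·L lattice a) y → lattice (λ k → α k + a (σ ⟨$⟩ʳ k)) y
      into (x , lift x∈L , y≈ξx) = lift λ k →
        ≤∞-respʳ (sym (v-cong (≈-trans (y≈ξx k) (monomial-⊛ x k)))) (v-·-monoˡ (v-ϖ^ (α k)) (x∈L (σ ⟨$⟩ʳ k)))
      onto : lattice (λ k → α k + a (σ ⟨$⟩ʳ k)) y → (ξ ·L lattice a) y
      onto (lift y∈L′) = x , lift x∈L , y≈ξx
        where
        x₀ : Vect n
        x₀ k = ϖ^ (α k) ⁻¹ · y k
        x : Vect n
        x j = x₀ (σ ⟨$⟩ˡ j)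
        x∈L : ∀ j → fin (a j) ≤∞ v (x j)
        x∈L j = ≤∞-respˡ (trans (-[x]+[x+y]≡y (α (σ ⟨$⟩ˡ j)) _) (cong a (inverseʳ σ)))
                         (v-·-monoˡ (v-ϖ^⁻¹ (α (σ ⟨$⟩ˡ j))) (y∈L′ (σ ⟨$⟩ˡ j)))
        y≈ξx : y ≈ⱽ ξ ⊛ x
        y≈ξx k = ≈-sym (begin
          (ξ ⊛ x) k                             ≈⟨ monomial-⊛ x k ⟩
          ϖ^ (α k) · x₀ (σ ⟨$⟩ˡ (σ ⟨$⟩ʳ k))    ≡⟨ cong (λ i → ϖ^ (α k) · x₀ i) (inverseˡ σ) ⟩
          ϖ^ (α k) · x₀ k                       ≈⟨ ϖ^-cancelˡ (α k) (y k) ⟩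
          y k                                   ∎)
          where open SetoidReasoning setoid

    monomial-distinguished-vertex : ∀ (μ μ′ : ExpMat n) → (∀ i j → μ′ i j ≡ conjExponents σ α μ i j) →
      ∀ i → SameClass (ξ ·L lattice (P μ (σ ⟨$⟩ʳ i))) (lattice (P μ′ i))
    monomial-distinguished-vertex μ μ′ μ′≡ i =
      ϖ^ (α i) ⁻¹ , v-nonzero (v-ϖ^⁻¹ (α i)) ,
      ≐-trans (lattice-cong (λ k → μ′≡ k i))
        (≐-trans (lattice-homothety _ (α i)) (·s-cong _ (≐-sym (monomial-·L-lattice (P μ (σ ⟨$⟩ʳ i))))))

    module _ {ξinv : Mat n} (ξinv⊗ξ≈I : ξinv ⊗ ξ ≈ᴹ I) where
      monomial-inverse : ∀ l k → ξinv l k ≈ I l (σ ⟨$⟩ʳ k) · ϖ^ (α k) ⁻¹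
      monomial-inverse l k = begin
        ξinv l k                                  ≈⟨ ≈-sym (ϖ^-cancelʳ (α k) _) ⟩
        (ξinv l k · ϖ^ (α k)) · ϖ^ (α k) ⁻¹       ≈⟨ ·-cong (·-cong ≈-refl (≈-sym (monomial-on k))) ≈-refl ⟩
        (ξinv l k · ξ k (σ ⟨$⟩ʳ k)) · ϖ^ (α k) ⁻¹ ≈⟨ ·-cong (≈-sym (sum-single _ k vanishes)) ≈-refl ⟩
        (ξinv ⊗ ξ) l (σ ⟨$⟩ʳ k) · ϖ^ (α k) ⁻¹     ≈⟨ ·-cong (ξinv⊗ξ≈I l (σ ⟨$⟩ʳ k)) ≈-refl ⟩
        I l (σ ⟨$⟩ʳ k) · ϖ^ (α k) ⁻¹              ∎
        where
        open SetoidReasoning setoid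
        vanishes : ∀ m → m ≢ k → ξinv l m · ξ m (σ ⟨$⟩ʳ k) ≈ 0#
        vanishes m m≢k = ≈-trans (·-cong ≈-refl (monomial-off (λ σm≡σk → m≢k (σ-injective σm≡σk)))) (zeroʳ _)

      conj-entry : ∀ N i j → ((ξ ⊗ N) ⊗ ξinv) i j ≈ (ϖ^ (α i) · N (σ ⟨$⟩ʳ i) (σ ⟨$⟩ʳ j)) · ϖ^ (α j) ⁻¹
      conj-entry N i j = begin
        ((ξ ⊗ N) ⊗ ξinv) i j                             ≈⟨ sum-single _ (σ ⟨$⟩ʳ j) vanishes ⟩
        (ξ ⊗ N) i (σ ⟨$⟩ʳ j) · ξinv (σ ⟨$⟩ʳ j) j          ≈⟨ ·-cong (monomial-⊛ (λ k → N k (σ ⟨$⟩ʳ j)) i)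
                                                                    (monomial-inverse (σ ⟨$⟩ʳ j) j) ⟩
        (ϖ^ (α i) · N (σ ⟨$⟩ʳ i) (σ ⟨$⟩ʳ j)) · (I (σ ⟨$⟩ʳ j) (σ ⟨$⟩ʳ j) · ϖ^ (α j) ⁻¹)
                                                          ≈⟨ ·-cong ≈-refl (≈-trans (·-cong (I-diagonal (σ ⟨$⟩ʳ j)) ≈-refl) (·-identityˡ _)) ⟩
        (ϖ^ (α i) · N (σ ⟨$⟩ʳ i) (σ ⟨$⟩ʳ j)) · ϖ^ (α j) ⁻¹ ∎
        where
        open SetoidReasoning setoid
        vanishes : ∀ l → l ≢ σ ⟨$⟩ʳ j → (ξ ⊗ N) i l · ξinv l j ≈ 0#
        vanishes l l≢σj = ≈-trans (·-cong ≈-refl (≈-trans (monomial-inverse l j)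
                            (≈-trans (·-cong (I-off-diagonal l≢σj) ≈-refl) (zeroˡ _)))) (zeroʳ _)

      conj-tiled : ∀ μ → HasExponents (conj ξ ξinv (tiled μ)) (conjExponents σ α μ)
      conj-tiled μ M = into , onto
        where
        into : conj ξ ξinv (tiled μ) M → tiled (conjExponents σ α μ) M
        into (N , lift N∈Γ , M≈ξNξ⁻¹) = lift λ i j →
          ≤∞-respʳ (sym (v-cong (≈-trans (M≈ξNξ⁻¹ i j) (conj-entry N i j))))
            (v-·-monoʳ (v-ϖ^⁻¹ (α j)) (v-·-monoˡ (v-ϖ^ (α i)) (N∈Γ (σ ⟨$⟩ʳ i) (σ ⟨$⟩ʳ j))))
        onto : tiled (conjExponents σ α μ) M → conj ξ ξinv (tiled μ) M
        onto (lift M∈Γ′) = N , lift N∈Γ , M≈ξNξ⁻¹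
          where
          untwist : ∀ a x b → (- a + ((a + x) - b)) + b ≡ x
          untwist = solve-∀
          N₀ : Mat n
          N₀ i j = (ϖ^ (α i) ⁻¹ · M i j) · ϖ^ (α j)
          N : Mat n
          N k l = N₀ (σ ⟨$⟩ˡ k) (σ ⟨$⟩ˡ l)
          N∈Γ : ∀ k l → fin (μ k l) ≤∞ v (N k l)
          N∈Γ k l = ≤∞-respˡ (trans (untwist (α (σ ⟨$⟩ˡ k)) _ (α (σ ⟨$⟩ˡ l))) (cong₂ μ (inverseʳ σ) (inverseʳ σ)))
            (v-·-monoʳ (v-ϖ^ (α (σ ⟨$⟩ˡ l))) (v-·-monoˡ (v-ϖ^⁻¹ (α (σ ⟨$⟩ˡ k))) (M∈Γ′ (σ ⟨$⟩ˡ k) (σ ⟨$⟩ˡ l))))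
          M≈ξNξ⁻¹ : M ≈ᴹ (ξ ⊗ N) ⊗ ξinv
          M≈ξNξ⁻¹ i j = ≈-sym (begin
            ((ξ ⊗ N) ⊗ ξinv) i j                                ≈⟨ conj-entry N i j ⟩
            (ϖ^ (α i) · N (σ ⟨$⟩ʳ i) (σ ⟨$⟩ʳ j)) · ϖ^ (α j) ⁻¹  ≡⟨ cong₂ (λ k l → (ϖ^ (α i) · N₀ k l) · ϖ^ (α j) ⁻¹)
                                                                        (inverseˡ σ) (inverseˡ σ) ⟩
            (ϖ^ (α i) · N₀ i j) · ϖ^ (α j) ⁻¹                   ≈⟨ ϖ^-sandwich-cancel (α i) (α j) (M i j) ⟩
            M i j                                               ∎)
            where open SetoidReasoning setoid

corollary2p11 : ∀ {c ℓ} (K : ValuedDivisionRing c ℓ) (n : ℕ) (μ : ExpMat n)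
    → (∀ i → μ i i ≡ + 0)
    → (∀ i j k → μ i k ≤ μ i j + μ j k)
    → (σ : Permutation′ n) (α : Fin n → ℤ) (ξinv : Theory.Mat K n)
    → Theory.IsInverse K (Theory.monomial K σ α) ξinv
    → let open Theory K
          ξ = monomial σ α
          Γ′ = conj ξ ξinv (tiled μ)
      in Σ (ExpMat n) (λ μ′ → HasExponents Γ′ μ′)
         × (∀ μ′ → HasExponents Γ′ μ′
             → (∀ i j l → strInv μ′ i j l ≡ strInv μ (σ ⟨$⟩ʳ i) (σ ⟨$⟩ʳ j) (σ ⟨$⟩ʳ l))
             × (∀ i → tDist μ′ i ≡ tMono α + tDist μ (σ ⟨$⟩ʳ i) [mod n ])
             × (∀ i → SameClass (ξ ·L lattice (P μ (σ ⟨$⟩ʳ i))) (lattice (P μ′ i))))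
corollary2p11 K n μ _ _ σ α ξinv (_ , ξinv⊗ξ≈I) =
  (conjExponents σ α μ , Γ′-exponents) , λ μ′ Γ′-exponents′ →
    let μ′≡ = HasExponents-unique Γ′-exponents′ Γ′-exponents
    in (λ i j l → trans (strInv-cong μ′≡ i j l) (strInv-conjExponents σ α μ i j l))
     , (λ i → subst (λ t → t ≡ tMono α + tDist μ (σ ⟨$⟩ʳ i) [mod n ])
                    (sym (tDist-cong μ′≡ i)) (tDist-conjExponents σ α μ i))
     , monomial-distinguished-vertex μ μ′ μ′≡
  where
  open MonomialConjugation K
  open Monomial σ α
  Γ′-exponents : Theory.HasExponents K (Theory.conj K ξ ξinv (Theory.tiled K μ)) (conjExponents σ α μ)
  Γ′-exponents = conj-tiled ξinv⊗ξ≈I μ
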